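{- Let $n$ be a positive integer and $k$ a nonnegative integer. Then \[ \binom{2k}{k}^2\ \Bigm|\ \binom{2n}{n}\binom{n}{k}\binom{k+n}{2k}\binom{k+2n-1}{n-1}\binom{2k+4n-2}{k+2n-1}. \]
   Context: For integers $a\neq 0$ and $b$, $a\mid b$ means that $b/a$ is an integer. Binomial coefficients $\binom{a}{b}$ with $0\le a<b$ are $0$. -}

module Defs where

module Submission where

-- Write n = m + 1, u = C(2k,k) and N = k + 2n - 1.  For j ≤ M the
-- "central ratio" C(2M,M)·C(M,j) / C(2j,j) is a natural number: indexing it by
-- j and d = M - j, it satisfies the Pascal-like recursion
--   ratio (j+1) (d+1) = 4·ratio (j+1) d + ratio j (d+1),
-- which we take as its definition, and a factorial identity shows that it really
-- is this quotient.  The recursion also shows that it is even whenever d ≥ 1.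
-- For k ≤ n (otherwise C(n,k) = 0) the five factors then combine as follows:
--   C(2n,n)·C(n,k)        = u · ratio k (n-k)            (central ratio),
--   C(2N,N)·C(N,k)        = u · 2h                       (central ratio, even),
--   C(k+n,2k)·u           = C(k+n,k)·C(n,k)              (subset of a subset),
--   C(N,n-1)·C(k+n,k)     = C(N,k)·C(2n-1,n)             (subset of a subset),
--   2·C(2n-1,n)           = C(2n,n)                      (central binomial).
-- A purely algebraic rearrangement turns these into
--   product = (ratio k (n-k)² · h) · u².

open import Defs

open import Data.Nat
open import Data.Nat.Properties
open import Data.Nat.Divisibility
open import Data.Nat.DivMod using (_/_; m/n*n≡m)
open import Data.Nat.Combinatorics
open import Data.Nat.Tactic.RingSolver using (solve-∀)
open import Data.Product using (_,_)
open import Relation.Binary.PropositionalEquality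
open import Relation.Nullary using (yes; no)

C-factorial : ∀ a b → ((a + b) C a) * (a ! * b !) ≡ (a + b) !
C-factorial a b = begin
    ((a + b) C a) * (a ! * b !)
      ≡⟨ cong (λ x → ((a + b) C a) * (a ! * x !)) (sym (m+n∸m≡n a b)) ⟩
    ((a + b) C a) * denominator
      ≡⟨ cong (_* denominator) (nCk≡n!/k![n-k]! (m≤m+n a b)) ⟩
    ((a + b) ! / denominator) {{a !* ((a + b) ∸ a) !≢0}} * denominator
      ≡⟨ m/n*n≡m {{a !* ((a + b) ∸ a) !≢0}} (k![n∸k]!∣n! (m≤m+n a b)) ⟩
    (a + b) ! ∎
  where
  open ≡-Reasoning
  denominator : ℕ
  denominator = a ! * ((a + b) ∸ a) !

-- C(a+b,a) is positive, being a factor of the positive number (a+b)!.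
C-nonZero : ∀ a b → NonZero ((a + b) C a)
C-nonZero a b = m*n≢0⇒m≢0 ((a + b) C a) {{subst NonZero (sym (C-factorial a b)) ((a + b) !≢0)}}

C-symmetric : ∀ a b → ((a + b) C a) ≡ ((b + a) C b)
C-symmetric a b = *-cancelʳ-≡ ((a + b) C a) ((b + a) C b) (a ! * b !) {{a !* b !≢0}} (begin
    ((a + b) C a) * (a ! * b !)   ≡⟨ C-factorial a b ⟩
    (a + b) !                     ≡⟨ cong _! (+-comm a b) ⟩
    (b + a) !                     ≡⟨ C-factorial b a ⟨
    ((b + a) C b) * (b ! * a !)   ≡⟨ cong (((b + a) C b) *_) (*-comm (b !) (a !)) ⟩
    ((b + a) C b) * (a ! * b !)   ∎)
  where open ≡-Reasoning

-- Subset-of-a-subset identity: choosing an (a+b)-subset of an (a+b+c)-set and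
-- then an a-subset of it is the same as choosing the a-subset first and then
-- b of the remaining b+c elements.
C-subset-of-subset : ∀ a b c →
  ((a + b + c) C (a + b)) * ((a + b) C a) ≡ ((a + b + c) C a) * ((b + c) C b)
C-subset-of-subset a b c = *-cancelʳ-≡ _ _ (a ! * b ! * c !)
  {{m*n≢0 _ _ {{a !* b !≢0}} {{c !≢0}}}} (begin
    ((a + b + c) C (a + b)) * ((a + b) C a) * (a ! * b ! * c !)
      ≡⟨ regroupˡ ((a + b + c) C (a + b)) ((a + b) C a) (a !) (b !) (c !) ⟩
    ((a + b + c) C (a + b)) * (((a + b) C a) * (a ! * b !) * c !)
      ≡⟨ cong (λ x → ((a + b + c) C (a + b)) * (x * c !)) (C-factorial a b) ⟩
    ((a + b + c) C (a + b)) * ((a + b) ! * c !)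
      ≡⟨ C-factorial (a + b) c ⟩
    (a + b + c) !
      ≡⟨ cong _! (+-assoc a b c) ⟩
    (a + (b + c)) !
      ≡⟨ C-factorial a (b + c) ⟨
    ((a + (b + c)) C a) * (a ! * (b + c) !)
      ≡⟨ cong₂ (λ x y → (x C a) * (a ! * y)) (sym (+-assoc a b c)) (sym (C-factorial b c)) ⟩
    ((a + b + c) C a) * (a ! * (((b + c) C b) * (b ! * c !)))
      ≡⟨ regroupʳ ((a + b + c) C a) ((b + c) C b) (a !) (b !) (c !) ⟩
    ((a + b + c) C a) * ((b + c) C b) * (a ! * b ! * c !) ∎)
  where
  open ≡-Reasoning
  regroupˡ : ∀ x y p q r → x * y * (p * q * r) ≡ x * (y * (p * q) * r)
  regroupˡ = solve-∀
  regroupʳ : ∀ x y p q r → x * (p * (y * (q * r))) ≡ x * y * (p * q * r)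
  regroupʳ = solve-∀

-- The central binomial coefficient C(2m+2,m+1) is twice C(2m+1,m), by Pascal's
-- rule and symmetry.
C-central-succ : ∀ m → 2 * ((m + suc m) C m) ≡ (suc m + suc m) C suc m
C-central-succ m = begin
    2 * ((m + suc m) C m)                     ≡⟨ double ((m + suc m) C m) ⟩
    ((m + suc m) C m) + ((m + suc m) C m)     ≡⟨ cong (((m + suc m) C m) +_) symmetric ⟩
    ((m + suc m) C m) + ((m + suc m) C suc m) ≡⟨ nCk+nC[k+1]≡[n+1]C[k+1] (m + suc m) m ⟩
    (suc m + suc m) C suc m                   ∎
  where
  open ≡-Reasoning
  double : ∀ x → 2 * x ≡ x + x
  double = solve-∀
  symmetric : (m + suc m) C m ≡ (m + suc m) C suc m
  symmetric = trans (C-symmetric m (suc m)) (cong (_C suc m) (sym (+-suc m m)))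

-- The central ratio: centralRatio j d = C(2M,M)·C(M,j) / C(2j,j) with M = j+d
-- (see centralRatio-spec), defined through its recursion in (j, d).
centralRatio : ℕ → ℕ → ℕ
centralRatio zero    d       = (d + d) C d
centralRatio (suc j) zero    = 1
centralRatio (suc j) (suc d) = 4 * centralRatio (suc j) d + centralRatio j (suc d)

double-factorial-succ : ∀ a → (suc a + suc a) ! ≡ (suc a + suc a) * (suc (a + a) * (a + a) !)
double-factorial-succ a rewrite +-suc a a = refl

-- The arithmetic of the inductive step of centralRatio-factorial, with the
-- factorials (2j)!, M!, d!, (2M)!, j! abstracted to X, Y, D, T, J and M = j+d+1.
centralRatio-step : ∀ r₁ r₂ X Y D T J j d →
  r₁ * (((suc j + suc j) * (suc (j + j) * X)) * (Y * D)) ≡ T * (suc j * J) →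
  r₂ * (X * (Y * (suc d * D))) ≡ T * J →
  (4 * r₁ + r₂) * (((suc j + suc j) * (suc (j + j) * X)) * ((suc (suc (j + d)) * Y) * (suc d * D)))
    ≡ ((suc (suc (j + d)) + suc (suc (j + d))) * (suc (suc (j + d) + suc (j + d)) * T)) * (suc j * J)
centralRatio-step r₁ r₂ X Y D T J j d h₁ h₂ = begin
    (4 * r₁ + r₂) * (((suc j + suc j) * (suc (j + j) * X)) * ((suc (suc (j + d)) * Y) * (suc d * D)))
      ≡⟨ split r₁ r₂ X Y D j d ⟩
    w₁ * (r₁ * (((suc j + suc j) * (suc (j + j) * X)) * (Y * D))) + w₂ * (r₂ * (X * (Y * (suc d * D))))
      ≡⟨ cong₂ (λ x y → w₁ * x + w₂ * y) h₁ h₂ ⟩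
    w₁ * (T * (suc j * J)) + w₂ * (T * J)
      ≡⟨ combine T J j d ⟩
    ((suc (suc (j + d)) + suc (suc (j + d))) * (suc (suc (j + d) + suc (j + d)) * T)) * (suc j * J) ∎
  where
  open ≡-Reasoning
  w₁ w₂ : ℕ
  w₁ = 4 * suc (suc (j + d)) * suc d
  w₂ = (suc j + suc j) * suc (j + j) * suc (suc (j + d))
  split : ∀ r₁ r₂ X Y D j d →
    (4 * r₁ + r₂) * (((suc j + suc j) * (suc (j + j) * X)) * ((suc (suc (j + d)) * Y) * (suc d * D)))
      ≡ (4 * suc (suc (j + d)) * suc d) * (r₁ * (((suc j + suc j) * (suc (j + j) * X)) * (Y * D)))
        + ((suc j + suc j) * suc (j + j) * suc (suc (j + d))) * (r₂ * (X * (Y * (suc d * D))))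
  split = solve-∀
  -- 4(M+1)(d+1)(j+1) + (2j+2)(2j+1)(M+1) = (2M+2)(2M+1)(j+1), as 2(d+1)+(2j+1) = 2M+1
  combine : ∀ T J j d →
    (4 * suc (suc (j + d)) * suc d) * (T * (suc j * J))
      + ((suc j + suc j) * suc (j + j) * suc (suc (j + d))) * (T * J)
      ≡ ((suc (suc (j + d)) + suc (suc (j + d))) * (suc (suc (j + d) + suc (j + d)) * T)) * (suc j * J)
  combine = solve-∀

centralRatio-factorial : ∀ j d →
  centralRatio j d * ((j + j) ! * ((j + d) ! * d !)) ≡ ((j + d) + (j + d)) ! * j !
centralRatio-factorial zero d = begin
    ((d + d) C d) * (1 * (d ! * d !)) ≡⟨ cong (((d + d) C d) *_) (*-identityˡ (d ! * d !)) ⟩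
    ((d + d) C d) * (d ! * d !)       ≡⟨ C-factorial d d ⟩
    (d + d) !                         ≡⟨ *-identityʳ ((d + d) !) ⟨
    (d + d) ! * 1                     ∎
  where open ≡-Reasoning
centralRatio-factorial (suc j) zero rewrite +-identityʳ j = unit ((suc j + suc j) !) (suc j !)
  where
  unit : ∀ x y → 1 * (x * (y * 1)) ≡ x * y
  unit = solve-∀
centralRatio-factorial (suc j) (suc d) rewrite +-suc j d =
  trans (cong (λ z → (4 * centralRatio (suc j) d + centralRatio j (suc d))
                       * (z * (suc (suc (j + d)) ! * suc d !))) (double-factorial-succ j))
  (trans (centralRatio-step (centralRatio (suc j) d) (centralRatio j (suc d))
            ((j + j) !) (suc (j + d) !) (d !) ((suc (j + d) + suc (j + d)) !) (j !) j d
            ih₁ ih₂)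
         (cong (_* suc j !) (sym (double-factorial-succ (suc (j + d))))))
  where
  ih₁ : centralRatio (suc j) d * (((suc j + suc j) * (suc (j + j) * (j + j) !)) * (suc (j + d) ! * d !))
          ≡ (suc (j + d) + suc (j + d)) ! * (suc j * j !)
  ih₁ = subst (λ z → centralRatio (suc j) d * (z * (suc (j + d) ! * d !))
                       ≡ (suc (j + d) + suc (j + d)) ! * (suc j * j !))
              (double-factorial-succ j) (centralRatio-factorial (suc j) d)
  ih₂ : centralRatio j (suc d) * ((j + j) ! * (suc (j + d) ! * (suc d * d !)))
          ≡ (suc (j + d) + suc (j + d)) ! * j !
  ih₂ = subst (λ z → centralRatio j (suc d) * ((j + j) ! * (z ! * suc d !)) ≡ ((z + z) !) * j !)
              (+-suc j d) (centralRatio-factorial j (suc d))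

-- The central ratio is the quotient C(2M,M)·C(M,j) / C(2j,j), M = j+d: both
-- sides times M!²·j!²·d! equal (2M)!·j!·M!.
centralRatio-spec : ∀ j d →
  centralRatio j d * ((j + j) C j) ≡ (((j + d) + (j + d)) C (j + d)) * ((j + d) C j)
centralRatio-spec j d = *-cancelʳ-≡ _ _ (M ! * (M ! * (j ! * (j ! * d !)))) {{clearing-nonZero}} (begin
    centralRatio j d * ((j + j) C j) * (M ! * (M ! * (j ! * (j ! * d !))))
      ≡⟨ regroupˡ (centralRatio j d) ((j + j) C j) (j !) (M !) (d !) ⟩
    centralRatio j d * (((j + j) C j) * (j ! * j !) * (M ! * d !)) * M !
      ≡⟨ cong (λ x → centralRatio j d * (x * (M ! * d !)) * M !) (C-factorial j j) ⟩
    centralRatio j d * ((j + j) ! * (M ! * d !)) * M !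
      ≡⟨ cong (_* M !) (centralRatio-factorial j d) ⟩
    (M + M) ! * j ! * M !
      ≡⟨ cong₂ (λ x y → x * j ! * y) (C-factorial M M) (C-factorial j d) ⟨
    ((M + M) C M) * (M ! * M !) * j ! * ((M C j) * (j ! * d !))
      ≡⟨ regroupʳ ((M + M) C M) (M C j) (j !) (M !) (d !) ⟩
    ((M + M) C M) * (M C j) * (M ! * (M ! * (j ! * (j ! * d !)))) ∎)
  where
  open ≡-Reasoning
  M : ℕ
  M = j + d
  clearing-nonZero : NonZero (M ! * (M ! * (j ! * (j ! * d !))))
  clearing-nonZero = m*n≢0 _ _ {{M !≢0}} {{m*n≢0 _ _ {{M !≢0}} {{m*n≢0 _ _ {{j !≢0}} {{j !* d !≢0}}}}}}
  regroupˡ : ∀ r c J Y D → r * c * (Y * (Y * (J * (J * D)))) ≡ r * (c * (J * J) * (Y * D)) * Y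
  regroupˡ = solve-∀
  regroupʳ : ∀ a b J Y D → a * (Y * Y) * J * (b * (J * D)) ≡ a * b * (Y * (Y * (J * (J * D))))
  regroupʳ = solve-∀

centralRatio-even : ∀ j d → 2 ∣ centralRatio j (suc d)
centralRatio-even zero d = divides ((d + suc d) C d) (begin
    (suc d + suc d) C suc d     ≡⟨ C-central-succ d ⟨
    2 * ((d + suc d) C d)       ≡⟨ *-comm 2 ((d + suc d) C d) ⟩
    ((d + suc d) C d) * 2       ∎)
  where open ≡-Reasoning
centralRatio-even (suc j) d =
  ∣m∣n⇒∣m+n (∣-trans (divides 2 refl) (m∣m*n (centralRatio (suc j) d))) (centralRatio-even j d)

product-factorisation : ∀ A B K D E u r h CN CNk H → .{{NonZero u}} →
  r * u ≡ A * B → (h * 2) * u ≡ E * CN → K * u ≡ CNk * B → D * CNk ≡ CN * H → 2 * H ≡ A →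
  A * B * K * D * E ≡ (r * r * h) * u ^ 2
product-factorisation A B K D E u r h CN CNk H ratio even subset₁ subset₂ central =
  *-cancelʳ-≡ _ _ u (begin
    A * B * K * D * E * u           ≡⟨ solve₁ A B K D E u ⟩
    A * B * D * E * (K * u)         ≡⟨ cong (A * B * D * E *_) subset₁ ⟩
    A * B * D * E * (CNk * B)       ≡⟨ solve₂ A B D E CNk ⟩
    A * B * B * E * (D * CNk)       ≡⟨ cong (A * B * B * E *_) subset₂ ⟩
    A * B * B * E * (CN * H)        ≡⟨ solve₃ A B E CN H ⟩
    A * B * B * (E * CN) * H        ≡⟨ cong (λ x → A * B * B * x * H) even ⟨
    A * B * B * (h * 2 * u) * H     ≡⟨ solve₄ A B h u H ⟩
    A * B * (B * h * u) * (2 * H)   ≡⟨ cong (A * B * (B * h * u) *_) central ⟩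
    A * B * (B * h * u) * A         ≡⟨ solve₅ A B h u ⟩
    (A * B) * (A * B) * h * u       ≡⟨ cong (λ x → x * x * h * u) ratio ⟨
    (r * u) * (r * u) * h * u       ≡⟨ solve₆ r u h ⟩
    r * r * h * u ^ 2 * u           ∎)
  where
  open ≡-Reasoning
  solve₁ : ∀ A B K D E u → A * B * K * D * E * u ≡ A * B * D * E * (K * u)
  solve₁ = solve-∀
  solve₂ : ∀ A B D E CNk → A * B * D * E * (CNk * B) ≡ A * B * B * E * (D * CNk)
  solve₂ = solve-∀
  solve₃ : ∀ A B E CN H → A * B * B * E * (CN * H) ≡ A * B * B * (E * CN) * H
  solve₃ = solve-∀
  solve₄ : ∀ A B h u H → A * B * B * (h * 2 * u) * H ≡ A * B * (B * h * u) * (2 * H)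
  solve₄ = solve-∀
  solve₅ : ∀ A B h u → A * B * (B * h * u) * A ≡ (A * B) * (A * B) * h * u
  solve₅ = solve-∀
  -- u ^ 2 unfolds to u * (u * 1)
  solve₆ : ∀ r u h → (r * u) * (r * u) * h * u ≡ r * r * h * (u * (u * 1)) * u
  solve₆ = solve-∀

module Factors (m k d : ℕ) (k+d≡n : k + d ≡ suc m) where

  open ≡-Reasoning

  twice : ∀ x → 2 * x ≡ x + x
  twice = solve-∀

  N : ℕ
  N = k + suc (m + m)

  u A B K D E CN CNk H : ℕ
  u   = (2 * k) C k
  A   = (2 * suc m) C suc m
  B   = suc m C k
  K   = (k + suc m) C (2 * k)
  D   = (k + 2 * suc m ∸ 1) C m
  E   = (2 * k + 4 * suc m ∸ 2) C (k + 2 * suc m ∸ 1)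
  CN  = N C k
  CNk = (k + suc m) C k
  H   = (suc m + m) C suc m

  N-index : k + 2 * suc m ∸ 1 ≡ N
  N-index = cong (_∸ 1) (shift k m)
    where
    shift : ∀ k m → k + 2 * suc m ≡ suc (k + suc (m + m))
    shift = solve-∀

  2N-index : 2 * k + 4 * suc m ∸ 2 ≡ N + N
  2N-index = cong (_∸ 2) (shift k m)
    where
    shift : ∀ k m → 2 * k + 4 * suc m ≡ suc (suc (k + suc (m + m) + (k + suc (m + m))))
    shift = solve-∀

  u-nonZero : NonZero u
  u-nonZero = subst NonZero (cong (_C k) (sym (twice k))) (C-nonZero k k)

  ratio : centralRatio k d * u ≡ A * B
  ratio = begin
    centralRatio k d * ((2 * k) C k)            ≡⟨ cong (λ x → centralRatio k d * (x C k)) (twice k) ⟩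
    centralRatio k d * ((k + k) C k)            ≡⟨ centralRatio-spec k d ⟩
    (((k + d) + (k + d)) C (k + d)) * ((k + d) C k) ≡⟨ cong (λ n → ((n + n) C n) * (n C k)) k+d≡n ⟩
    ((suc m + suc m) C suc m) * B               ≡⟨ cong (λ x → (x C suc m) * B) (twice (suc m)) ⟨
    A * B                                       ∎

  even : ∀ h → centralRatio k (suc (m + m)) ≡ h * 2 → (h * 2) * u ≡ E * CN
  even h ratio≡2h = begin
    (h * 2) * u                                 ≡⟨ cong₂ _*_ (sym ratio≡2h) (cong (_C k) (twice k)) ⟩
    centralRatio k (suc (m + m)) * ((k + k) C k) ≡⟨ centralRatio-spec k (suc (m + m)) ⟩
    ((N + N) C N) * CN                          ≡⟨ cong₂ (λ x y → (x C y) * CN) 2N-index N-index ⟨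
    E * CN                                      ∎

  subset₁ : K * u ≡ CNk * B
  subset₁ = begin
    K * u                                   ≡⟨ cong₂ (λ x y → (x C y) * (y C k)) (sym k+k+d≡k+n) (twice k) ⟩
    ((k + k + d) C (k + k)) * ((k + k) C k) ≡⟨ C-subset-of-subset k k d ⟩
    ((k + k + d) C k) * ((k + d) C k)       ≡⟨ cong₂ (λ x y → (x C k) * (y C k)) k+k+d≡k+n k+d≡n ⟩
    CNk * B                                 ∎
    where
    k+k+d≡k+n : k + k + d ≡ k + suc m
    k+k+d≡k+n = trans (+-assoc k k d) (cong (k +_) k+d≡n)

  subset₂ : D * CNk ≡ CN * H
  subset₂ = begin
    D * CNk                                     ≡⟨ cong (λ x → (x C m) * CNk) (trans N-index N≡m+[k+n]) ⟩
    ((m + (k + suc m)) C m) * CNk               ≡⟨ cong (_* CNk) (C-symmetric (k + suc m) m) ⟨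
    ((k + suc m + m) C (k + suc m)) * CNk       ≡⟨ C-subset-of-subset k (suc m) m ⟩
    ((k + suc m + m) C k) * H                   ≡⟨ cong (λ x → (x C k) * H) (+-assoc k (suc m) m) ⟩
    CN * H                                      ∎
    where
    N≡m+[k+n] : N ≡ m + (k + suc m)
    N≡m+[k+n] = rearrange k m
      where
      rearrange : ∀ k m → k + suc (m + m) ≡ m + (k + suc m)
      rearrange = solve-∀

  central : 2 * H ≡ A
  central = begin
    2 * ((suc m + m) C suc m)   ≡⟨ cong (2 *_) (C-symmetric (suc m) m) ⟩
    2 * ((m + suc m) C m)       ≡⟨ C-central-succ m ⟩
    (suc m + suc m) C suc m     ≡⟨ cong (_C suc m) (twice (suc m)) ⟨
    A                           ∎

lemma2p5 : (n k : ℕ) → 1 ≤ n →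
    ((2 * k) C k) ^ 2 ∣
    ((2 * n) C n) * (n C k) * ((k + n) C (2 * k)) * ((k + 2 * n ∸ 1) C (n ∸ 1))
    * ((2 * k + 4 * n ∸ 2) C (k + 2 * n ∸ 1))
lemma2p5 zero    k ()
lemma2p5 (suc m) k _ with k ≤? suc m
... | no k≰n rewrite k>n⇒nCk≡0 (≰⇒> k≰n) | *-zeroʳ ((2 * suc m) C suc m) = _ ∣0
... | yes k≤n with m≤n⇒∃[o]m+o≡n k≤n
...   | d , k+d≡n with centralRatio-even k (m + m)
...     | divides h ratio≡2h =
  divides (r * r * h)
    (product-factorisation A B K D E u r h CN CNk H {{u-nonZero}}
      ratio (even h ratio≡2h) subset₁ subset₂ central)
  where
  open Factors m k d k+d≡n
  r : ℕ
  r = centralRatio k d
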